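{- For every integer $n>3$, the circulant matrix $\operatorname{circ}(3,1,0,\ldots,0,1)$ of order $n$ is invertible and \[[\operatorname{circ}(3,1,0,\ldots,0,1)]^{ -1}=\operatorname{circ}(a_0,a_1,\ldots,a_{n-1}),\] where for $j=0,1,\ldots,n-1$, \[a_j=\frac{2^{n-j}}{\sqrt{5}}\left[\frac{(-3+\sqrt{5})^j}{2^n-(-3+\sqrt{5})^n}-\frac{(-3-\sqrt{5})^j}{2^n-(-3-\sqrt{5})^n}\right].\]
   Context: For real numbers $c_0,\ldots,c_{k-1}$, $\operatorname{circ}(c_0,c_1,\ldots,c_{k-1})$ denotes the $k\times k$ circulant matrix whose $(i,j)$-entry is $c_{(j-i)\bmod k}$. Thus $\operatorname{circ}(3,1,0,\ldots,0,1)$ has $3$ on the diagonal, $1$ on the cyclic super- and sub-diagonals, and $0$ elsewhere. -}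

module Defs where

open import Data.Nat as ℕ using (ℕ; zero; suc; _∸_)
open import Data.Nat.DivMod using (_mod_)
open import Data.Fin using (Fin; toℕ)
open import Data.Rational as ℚ using (ℚ; 0ℚ; 1ℚ)
open import Data.Integer using (+_)
open import Data.Rational.Properties using () renaming (_≟_ to _≟ℚ_)
open import Data.Bool using (Bool; true; false; if_then_else_; _∨_)
open import Relation.Nullary using (yes; no; does)
open import Relation.Binary.PropositionalEquality using (_≡_)

-- The real quadratic field ℚ(√5) ⊂ ℝ : re + im·√5  (re, im ∈ ℚ).
-- Every number occurring in the theorem lies in this subfield of ℝ, and
-- field operations of ℝ restricted to ℚ(√5) are the ones below.

infix 4 _+√5·_

record ℚ√5 : Set where
  constructor _+√5·_
  field
    re : ℚ
    im : ℚ
open ℚ√5 public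

infixl 6 _+ₖ_ _-ₖ_
infixl 7 _*ₖ_

ℚℕ : ℕ → ℚ
ℚℕ n = (+ n) ℚ./ 1

fromℚ : ℚ → ℚ√5
fromℚ q = q +√5· 0ℚ

fromℕ : ℕ → ℚ√5
fromℕ n = fromℚ (ℚℕ n)

0ₖ 1ₖ √5 : ℚ√5
0ₖ = fromℚ 0ℚ
1ₖ = fromℚ 1ℚ
√5 = 0ℚ +√5· 1ℚ

_+ₖ_ : ℚ√5 → ℚ√5 → ℚ√5
(a +√5· b) +ₖ (c +√5· d) = (a ℚ.+ c) +√5· (b ℚ.+ d)

-ₖ_ : ℚ√5 → ℚ√5
-ₖ (a +√5· b) = ℚ.- a +√5· ℚ.- b

_-ₖ_ : ℚ√5 → ℚ√5 → ℚ√5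
x -ₖ y = x +ₖ (-ₖ y)

_*ₖ_ : ℚ√5 → ℚ√5 → ℚ√5
(a +√5· b) *ₖ (c +√5· d) =
  (a ℚ.* c ℚ.+ ℚℕ 5 ℚ.* b ℚ.* d) +√5· (a ℚ.* d ℚ.+ b ℚ.* c)

-- Multiplicative inverse (1/(a+b√5) = (a-b√5)/(a²-5b²)); totalised by
-- inv 0 = 0 (a²-5b² = 0 only for a = b = 0 since √5 is irrational).
invₖ : ℚ√5 → ℚ√5
invₖ (a +√5· b) with (a ℚ.* a ℚ.- ℚℕ 5 ℚ.* b ℚ.* b) ≟ℚ 0ℚ
... | yes _ = 0ₖ
... | no d≢0 = let instance _ = ℚ.≢-nonZero d≢0
                   d = a ℚ.* a ℚ.- ℚℕ 5 ℚ.* b ℚ.* b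
               in (a ℚ.* ℚ.1/ d) +√5· (ℚ.- b ℚ.* ℚ.1/ d)

_/ₖ_ : ℚ√5 → ℚ√5 → ℚ√5
x /ₖ y = x *ₖ invₖ y

_^ₖ_ : ℚ√5 → ℕ → ℚ√5
x ^ₖ zero  = 1ₖ
x ^ₖ suc n = x *ₖ (x ^ₖ n)

Matrix : ℕ → Set
Matrix n = Fin n → Fin n → ℚ√5

sumₖ : ∀ {n} → (Fin n → ℚ√5) → ℚ√5
sumₖ {zero}  f = 0ₖ
sumₖ {suc n} f = f Data.Fin.zero +ₖ sumₖ (λ i → f (Data.Fin.suc i))

_⊗_ : ∀ {n} → Matrix n → Matrix n → Matrix n
(A ⊗ B) i k = sumₖ (λ j → A i j *ₖ B j k)

identity : ∀ {n} → Matrix n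
identity i j = if does (i Data.Fin.≟ j) then 1ₖ else 0ₖ

circ : ∀ {n} → (Fin n → ℚ√5) → Matrix n
circ {zero}  c ()
circ {suc m} c i j = c ((suc m ℕ.+ toℕ j ∸ toℕ i) mod suc m)

row31 : (n : ℕ) → Fin n → ℚ√5
row31 n j =
  if does (toℕ j ℕ.≟ 0) then fromℕ 3
  else if does (toℕ j ℕ.≟ 1) ∨ does (toℕ j ℕ.≟ (n ∸ 1)) then 1ₖ
  else 0ₖ

coeff : (n : ℕ) → Fin n → ℚ√5
coeff n j =
  ((fromℕ 2 ^ₖ (n ∸ toℕ j)) /ₖ √5) *ₖ
    ( ((x₊ ^ₖ toℕ j) /ₖ ((fromℕ 2 ^ₖ n) -ₖ (x₊ ^ₖ n)))
   -ₖ ((x₋ ^ₖ toℕ j) /ₖ ((fromℕ 2 ^ₖ n) -ₖ (x₋ ^ₖ n))) )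
  where
  x₊ = (-ₖ fromℕ 3) +ₖ √5
  x₋ = (-ₖ fromℕ 3) -ₖ √5

IsInverse : ∀ {n} → Matrix n → Matrix n → Set
IsInverse A B = (∀ i j → (A ⊗ B) i j ≡ identity i j)
              Data.Product.× (∀ i j → (B ⊗ A) i j ≡ identity i j)
  where import Data.Product

module Submission where

-- Let x± = -3 ± √5 be the roots of x² + 6x + 4, w±(j) = 2^(n-j) x±^j and
-- D± = 2^n - x±^n = w±(0) - w±(n), so that a_j = (w₊(j)/D₊ - w₋(j)/D₋)/√5.
-- As x± is a root, w(j) + 3w(j+1) + w(j+2) = 0, so 3a_t + a_(t-1) + a_(t+1) = 0 for
-- 0 < t < n-1. The wrap-around at t = n-1 turns the combination of w± into D±, giving
-- D₊/D₊ - D₋/D₋ = 0, and at t = 0 into ((x± + 6)/2)·D±, giving ((x₊ - x₋)/2)/√5 = 1.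
-- Thus the cyclic convolution of the rows (3,1,0,…,0,1) and (a_j) is (1,0,…,0); as a product
-- of circulants is the circulant of the (commutative) convolution of their first rows, both
-- products are the identity. D± ≠ 0: writing (3 + √5)^n = A_n + B_n√5, x±^n = (-1)^n (A_n ∓ B_n√5)
-- has norm 4^n, so the norm of D± is 2^(n+1)(2^n - (-1)^n A_n), which is nonzero as A_n ≥ 3^n > 2^n.

open import Defs
open import Algebra.Bundles using (CommutativeRing)
import Algebra.Properties.CommutativeMonoid.Sum as MonoidSum
open import Data.Bool using (if_then_else_)
open import Data.Bool.Properties using (∨-zeroʳ)
open import Data.Empty using (⊥-elim)
open import Data.Fin as Fin using (Fin; zero; suc; toℕ; inject₁)
import Data.Fin.Properties as FinP
open import Data.Fin.Permutation using (permutation)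
import Data.Integer as ℤ
import Data.Integer.Properties as ℤP
open import Data.Nat as ℕ using (ℕ; zero; suc; _<_; _≤_)
open import Data.Nat.Coprimality using (1-coprimeTo) renaming (sym to coprime-sym)
open import Data.Nat.DivMod using (_mod_; %-distribˡ-+; m%n%n≡m%n; [m+n]%n≡m%n; [m+kn]%n≡m%n; m<n⇒m%n≡m; m%n<n; n%n≡0)
import Data.Nat.Properties as ℕP
import Data.Nat.Tactic.RingSolver as NatSolver
open import Data.Product using (_,_; proj₁; proj₂)
open import Data.Rational as ℚ using (ℚ; 0ℚ; 1ℚ; mkℚ; ½)
import Data.Rational.Properties as ℚP
open import Data.Sum using (_⊎_; inj₁; inj₂; [_,_]′)
open import Function using (_∘_; _$_)
open import Relation.Binary.PropositionalEquality
open import Algebra.Definitions {A = ℚ√5} (_≡_)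
  using (Associative; Commutative; LeftIdentity; LeftInverse; _DistributesOverˡ_)
open import Relation.Nullary using (Dec; yes; no; does)
open import Relation.Nullary.Decidable using (dec⇒maybe; dec-true; dec-false)
open import Tactic.RingSolver using (solve-∀)
open import Tactic.RingSolver.Core.AlmostCommutativeRing using (AlmostCommutativeRing; fromCommutativeRing)

ℚ-ring : AlmostCommutativeRing _ _
ℚ-ring = fromCommutativeRing ℚP.+-*-commutativeRing (λ q → dec⇒maybe (0ℚ ℚP.≟ q))

+√5·-cong : ∀ {a b c d} → a ≡ c → b ≡ d → (a +√5· b) ≡ (c +√5· d)
+√5·-cong = cong₂ _+√5·_

_≟ₖ_ : (x y : ℚ√5) → Dec (x ≡ y)
(a +√5· b) ≟ₖ (c +√5· d) with a ℚP.≟ c | b ℚP.≟ d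
... | yes a≡c | yes b≡d = yes (+√5·-cong a≡c b≡d)
... | no a≢c  | _       = no (a≢c ∘ cong re)
... | yes _   | no b≢d  = no (b≢d ∘ cong im)

+ₖ-assoc : Associative _+ₖ_
+ₖ-assoc (a +√5· b) (c +√5· d) (e +√5· f) = +√5·-cong (ℚP.+-assoc a c e) (ℚP.+-assoc b d f)

+ₖ-comm : Commutative _+ₖ_
+ₖ-comm (a +√5· b) (c +√5· d) = +√5·-cong (ℚP.+-comm a c) (ℚP.+-comm b d)

+ₖ-identityˡ : LeftIdentity 0ₖ _+ₖ_
+ₖ-identityˡ (a +√5· b) = +√5·-cong (ℚP.+-identityˡ a) (ℚP.+-identityˡ b)

-ₖ‿inverseˡ : LeftInverse 0ₖ (λ x → -ₖ x) _+ₖ_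
-ₖ‿inverseˡ (a +√5· b) = +√5·-cong (ℚP.+-inverseˡ a) (ℚP.+-inverseˡ b)

module _ where
  open import Data.Rational using (_+_; _*_)

  private
    five : ℚ
    five = ℚℕ 5

  *ₖ-assoc : Associative _*ₖ_
  *ₖ-assoc (a +√5· b) (c +√5· d) (e +√5· f) = +√5·-cong (re-assoc a b c d e f) (im-assoc a b c d e f)
    where
    re-assoc : ∀ a b c d e f → (a * c + five * b * d) * e + five * (a * d + b * c) * f
                             ≡ a * (c * e + five * d * f) + five * b * (c * f + d * e)
    re-assoc = solve-∀ ℚ-ring
    im-assoc : ∀ a b c d e f → (a * c + five * b * d) * f + (a * d + b * c) * e
                             ≡ a * (c * f + d * e) + b * (c * e + five * d * f)
    im-assoc = solve-∀ ℚ-ring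

  *ₖ-comm : Commutative _*ₖ_
  *ₖ-comm (a +√5· b) (c +√5· d) = +√5·-cong (re-comm a b c d) (im-comm a b c d)
    where
    re-comm : ∀ a b c d → a * c + five * b * d ≡ c * a + five * d * b
    re-comm = solve-∀ ℚ-ring
    im-comm : ∀ a b c d → a * d + b * c ≡ c * b + d * a
    im-comm = solve-∀ ℚ-ring

  *ₖ-identityˡ : LeftIdentity 1ₖ _*ₖ_
  *ₖ-identityˡ (a +√5· b) = +√5·-cong (re-identity a b) (im-identity a b)
    where
    re-identity : ∀ a b → 1ℚ * a + five * 0ℚ * b ≡ a
    re-identity = solve-∀ ℚ-ring
    im-identity : ∀ a b → 1ℚ * b + 0ℚ * a ≡ b
    im-identity = solve-∀ ℚ-ring

  *ₖ-distribˡ-+ₖ : _*ₖ_ DistributesOverˡ _+ₖ_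
  *ₖ-distribˡ-+ₖ (a +√5· b) (c +√5· d) (e +√5· f) = +√5·-cong (re-distrib a b c d e f) (im-distrib a b c d e f)
    where
    re-distrib : ∀ a b c d e f → a * (c + e) + five * b * (d + f) ≡ (a * c + five * b * d) + (a * e + five * b * f)
    re-distrib = solve-∀ ℚ-ring
    im-distrib : ∀ a b c d e f → a * (d + f) + b * (c + e) ≡ (a * d + b * c) + (a * f + b * e)
    im-distrib = solve-∀ ℚ-ring

ℚ√5-commutativeRing : CommutativeRing _ _
ℚ√5-commutativeRing = record
  { Carrier           = ℚ√5
  ; _≈_               = _≡_
  ; _+_               = _+ₖ_
  ; _*_               = _*ₖ_
  ; -_                = λ x → -ₖ x
  ; 0#                = 0ₖ
  ; 1#                = 1ₖ
  ; isCommutativeRing = record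
    { isRing = record
      { +-isAbelianGroup = record
        { isGroup = record
          { isMonoid = record
            { isSemigroup = record
              { isMagma = record { isEquivalence = isEquivalence ; ∙-cong = cong₂ _+ₖ_ }
              ; assoc   = +ₖ-assoc }
            ; identity = +ₖ-identityˡ , λ x → trans (+ₖ-comm x 0ₖ) (+ₖ-identityˡ x) }
          ; inverse = -ₖ‿inverseˡ , λ x → trans (+ₖ-comm x (-ₖ x)) (-ₖ‿inverseˡ x)
          ; ⁻¹-cong = cong (λ x → -ₖ x) }
        ; comm = +ₖ-comm }
      ; *-cong     = cong₂ _*ₖ_
      ; *-assoc    = *ₖ-assoc
      ; *-identity = *ₖ-identityˡ , λ x → trans (*ₖ-comm x 1ₖ) (*ₖ-identityˡ x)
      ; distrib    = *ₖ-distribˡ-+ₖ , λ x y z → trans (*ₖ-comm (y +ₖ z) x)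
                       (trans (*ₖ-distribˡ-+ₖ x y z) (cong₂ _+ₖ_ (*ₖ-comm x y) (*ₖ-comm x z))) }
    ; *-comm = *ₖ-comm } }

ℚ√5-ring : AlmostCommutativeRing _ _
ℚ√5-ring = fromCommutativeRing ℚ√5-commutativeRing (λ x → dec⇒maybe (0ₖ ≟ₖ x))

private
  integral : ℕ → ℚ
  integral n = mkℚ (ℤ.+ n) 0 (coprime-sym (1-coprimeTo n))

  ℚℕ≡integral : ∀ n → ℚℕ n ≡ integral n
  ℚℕ≡integral n = ℚP.↥p/↧p≡p (integral n)

ℚℕ-+ : ∀ m n → ℚℕ (m ℕ.+ n) ≡ ℚℕ m ℚ.+ ℚℕ n
ℚℕ-+ m n = begin
  ℚℕ (m ℕ.+ n)
    ≡⟨ cong (ℚ._/ 1) (sym (cong₂ ℤ._+_ (ℤP.*-identityʳ (ℤ.+ m)) (ℤP.*-identityʳ (ℤ.+ n)))) ⟩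
  (ℤ.+ m ℤ.* ℤ.+ 1 ℤ.+ ℤ.+ n ℤ.* ℤ.+ 1) ℚ./ 1
    ≡⟨⟩
  integral m ℚ.+ integral n
    ≡⟨ cong₂ ℚ._+_ (ℚℕ≡integral m) (ℚℕ≡integral n) ⟨
  ℚℕ m ℚ.+ ℚℕ n ∎
  where open ≡-Reasoning

ℚℕ-* : ∀ m n → ℚℕ (m ℕ.* n) ≡ ℚℕ m ℚ.* ℚℕ n
ℚℕ-* m n = begin
  ℚℕ (m ℕ.* n)              ≡⟨ cong (ℚ._/ 1) (ℤP.pos-* m n) ⟩
  (ℤ.+ m ℤ.* ℤ.+ n) ℚ./ 1   ≡⟨⟩
  integral m ℚ.* integral n ≡⟨ cong₂ ℚ._*_ (ℚℕ≡integral m) (ℚℕ≡integral n) ⟨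
  ℚℕ m ℚ.* ℚℕ n             ∎
  where open ≡-Reasoning

ℚℕ-injective : ∀ {m n} → ℚℕ m ≡ ℚℕ n → m ≡ n
ℚℕ-injective {m} {n} eq = ℤP.+-injective (cong ℚ.↥_ (trans (sym (ℚℕ≡integral m)) (trans eq (ℚℕ≡integral n))))

norm : ℚ√5 → ℚ
norm (a +√5· b) = a ℚ.* a ℚ.- ℚℕ 5 ℚ.* b ℚ.* b

*ₖ-invₖ : ∀ z → norm z ≢ 0ℚ → z *ₖ invₖ z ≡ 1ₖ
*ₖ-invₖ (a +√5· b) N≢0 with norm (a +√5· b) ℚP.≟ 0ℚ
... | yes N≡0 = ⊥-elim (N≢0 N≡0)
... | no N≢0 = +√5·-cong (trans (re-part a b (ℚ.1/ N)) (ℚP.*-inverseʳ N)) (im-part a b (ℚ.1/ N))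
  where
  open import Data.Rational using (_+_; _-_; _*_; -_)
  N = norm (a +√5· b)
  instance _ = ℚ.≢-nonZero N≢0
  re-part : ∀ a b i → a * (a * i) + ℚℕ 5 * b * (- b * i) ≡ (a * a - ℚℕ 5 * b * b) * i
  re-part = solve-∀ ℚ-ring
  im-part : ∀ a b i → a * (- b * i) + b * (a * i) ≡ 0ℚ
  im-part = solve-∀ ℚ-ring

norm-*ₖ : ∀ x y → norm (x *ₖ y) ≡ norm x ℚ.* norm y
norm-*ₖ (a +√5· b) (c +√5· d) = brahmagupta a b c d
  where
  open import Data.Rational using (_+_; _-_; _*_)
  brahmagupta : ∀ a b c d → (a * c + ℚℕ 5 * b * d) * (a * c + ℚℕ 5 * b * d) - ℚℕ 5 * (a * d + b * c) * (a * d + b * c)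
                          ≡ (a * a - ℚℕ 5 * b * b) * (c * c - ℚℕ 5 * d * d)
  brahmagupta = solve-∀ ℚ-ring

norm-^ₖ : ∀ x c → norm x ≡ ℚℕ (c ℕ.* c) → ∀ n → norm (x ^ₖ n) ≡ ℚℕ (c ℕ.^ n ℕ.* c ℕ.^ n)
norm-^ₖ x c norm-x zero    = refl
norm-^ₖ x c norm-x (suc n) = begin
  norm (x *ₖ x ^ₖ n)                                       ≡⟨ norm-*ₖ x (x ^ₖ n) ⟩
  norm x ℚ.* norm (x ^ₖ n)                                 ≡⟨ cong₂ ℚ._*_ norm-x (norm-^ₖ x c norm-x n) ⟩
  ℚℕ (c ℕ.* c) ℚ.* ℚℕ (c ℕ.^ n ℕ.* c ℕ.^ n)                ≡⟨ ℚℕ-* (c ℕ.* c) _ ⟨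
  ℚℕ (c ℕ.* c ℕ.* (c ℕ.^ n ℕ.* c ℕ.^ n))                   ≡⟨ cong ℚℕ (regroup c (c ℕ.^ n)) ⟩
  ℚℕ (c ℕ.^ suc n ℕ.* c ℕ.^ suc n)                         ∎
  where
  open ≡-Reasoning
  regroup : ∀ c d → c ℕ.* c ℕ.* (d ℕ.* d) ≡ c ℕ.* d ℕ.* (c ℕ.* d)
  regroup = NatSolver.solve-∀

fromℕ-*ₖ : ∀ m n → fromℕ m *ₖ fromℕ n ≡ fromℕ (m ℕ.* n)
fromℕ-*ₖ m n = +√5·-cong (trans (re-part (ℚℕ m) (ℚℕ n)) (sym (ℚℕ-* m n))) (im-part (ℚℕ m) (ℚℕ n))
  where
  open import Data.Rational using (_+_; _*_)
  re-part : ∀ a b → a * b + ℚℕ 5 * 0ℚ * 0ℚ ≡ a * b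
  re-part = solve-∀ ℚ-ring
  im-part : ∀ a b → a * 0ℚ + 0ℚ * b ≡ 0ℚ
  im-part = solve-∀ ℚ-ring

fromℕ-^ₖ : ∀ m n → fromℕ m ^ₖ n ≡ fromℕ (m ℕ.^ n)
fromℕ-^ₖ m zero    = refl
fromℕ-^ₖ m (suc n) = trans (cong (fromℕ m *ₖ_) (fromℕ-^ₖ m n)) (fromℕ-*ₖ m (m ℕ.^ n))

-ₖ-^ₖ : ∀ z n → (-ₖ z) ^ₖ n ≡ z ^ₖ n ⊎ (-ₖ z) ^ₖ n ≡ -ₖ (z ^ₖ n)
-ₖ-^ₖ z zero = inj₁ refl
-ₖ-^ₖ z (suc n) with -ₖ-^ₖ z n
... | inj₁ even = inj₂ (trans (cong ((-ₖ z) *ₖ_) even) (flip z (z ^ₖ n)))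
  where
  flip : ∀ z p → (-ₖ z) *ₖ p ≡ -ₖ (z *ₖ p)
  flip = solve-∀ ℚ√5-ring
... | inj₂ odd  = inj₁ (trans (cong ((-ₖ z) *ₖ_) odd) (unflip z (z ^ₖ n)))
  where
  unflip : ∀ z p → (-ₖ z) *ₖ (-ₖ p) ≡ z *ₖ p
  unflip = solve-∀ ℚ√5-ring

A B : ℕ → ℕ
A zero    = 1
A (suc n) = 3 ℕ.* A n ℕ.+ 5 ℕ.* B n
B zero    = 0
B (suc n) = A n ℕ.+ 3 ℕ.* B n

3±√5-^ₖ : ∀ s → s ℚ.* s ≡ 1ℚ → ∀ n → (ℚℕ 3 +√5· s) ^ₖ n ≡ (ℚℕ (A n) +√5· s ℚ.* ℚℕ (B n))
3±√5-^ₖ s s²≡1 zero    = +√5·-cong refl (sym (ℚP.*-zeroʳ s))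
3±√5-^ₖ s s²≡1 (suc n) = begin
  (ℚℕ 3 +√5· s) *ₖ (ℚℕ 3 +√5· s) ^ₖ n     ≡⟨ cong ((ℚℕ 3 +√5· s) *ₖ_) (3±√5-^ₖ s s²≡1 n) ⟩
  (ℚℕ 3 +√5· s) *ₖ (a +√5· s ℚ.* b)       ≡⟨ +√5·-cong re-part im-part ⟩
  ℚℕ (A (suc n)) +√5· s ℚ.* ℚℕ (B (suc n)) ∎
  where
  open ≡-Reasoning
  open import Data.Rational using (_+_; _*_)
  a = ℚℕ (A n)
  b = ℚℕ (B n)
  re-part : ℚℕ 3 * a + ℚℕ 5 * s * (s * b) ≡ ℚℕ (3 ℕ.* A n ℕ.+ 5 ℕ.* B n)
  re-part = begin
    ℚℕ 3 * a + ℚℕ 5 * s * (s * b)   ≡⟨ regroup (ℚℕ 3) (ℚℕ 5) s a b ⟩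
    ℚℕ 3 * a + ℚℕ 5 * (s * s) * b   ≡⟨ cong (λ t → ℚℕ 3 * a + ℚℕ 5 * t * b) s²≡1 ⟩
    ℚℕ 3 * a + ℚℕ 5 * 1ℚ * b        ≡⟨ cong (λ t → ℚℕ 3 * a + t * b) (ℚP.*-identityʳ (ℚℕ 5)) ⟩
    ℚℕ 3 * a + ℚℕ 5 * b             ≡⟨ cong₂ _+_ (ℚℕ-* 3 (A n)) (ℚℕ-* 5 (B n)) ⟨
    ℚℕ (3 ℕ.* A n) + ℚℕ (5 ℕ.* B n) ≡⟨ ℚℕ-+ (3 ℕ.* A n) (5 ℕ.* B n) ⟨
    ℚℕ (3 ℕ.* A n ℕ.+ 5 ℕ.* B n)    ∎
    where
    regroup : ∀ k l s a b → k * a + l * s * (s * b) ≡ k * a + l * (s * s) * b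
    regroup = solve-∀ ℚ-ring
  im-part : ℚℕ 3 * (s * b) + s * a ≡ s * ℚℕ (A n ℕ.+ 3 ℕ.* B n)
  im-part = begin
    ℚℕ 3 * (s * b) + s * a          ≡⟨ regroup (ℚℕ 3) s a b ⟩
    s * (a + ℚℕ 3 * b)              ≡⟨ cong (λ t → s * (a + t)) (ℚℕ-* 3 (B n)) ⟨
    s * (a + ℚℕ (3 ℕ.* B n))        ≡⟨ cong (s *_) (ℚℕ-+ (A n) (3 ℕ.* B n)) ⟨
    s * ℚℕ (A n ℕ.+ 3 ℕ.* B n)      ∎
    where
    regroup : ∀ k s a b → k * (s * b) + s * a ≡ s * (a + k * b)
    regroup = solve-∀ ℚ-ring

3^n≤A : ∀ n → 3 ℕ.^ n ≤ A n
3^n≤A zero    = ℕP.≤-refl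
3^n≤A (suc n) = ℕP.≤-trans (ℕP.*-monoʳ-≤ 3 (3^n≤A n)) (ℕP.m≤m+n (3 ℕ.* A n) (5 ℕ.* B n))

2^n<A : ∀ n → 2 ℕ.^ suc n < A (suc n)
2^n<A n = ℕP.<-≤-trans (ℕP.^-monoˡ-< (suc n) (ℕP.n<1+n 2)) (3^n≤A (suc n))

norm-fromℕ-ₖ : ∀ c z → norm (fromℕ c -ₖ z) ≡ ℚℕ c ℚ.* ℚℕ c ℚ.+ norm z ℚ.- ℚℕ 2 ℚ.* ℚℕ c ℚ.* re z
norm-fromℕ-ₖ c (p +√5· q) = expand (ℚℕ c) p q
  where
  open import Data.Rational using (_+_; _-_; _*_; -_)
  expand : ∀ C p q → (C + - p) * (C + - p) - ℚℕ 5 * (0ℚ + - q) * (0ℚ + - q)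
                   ≡ C * C + (p * p - ℚℕ 5 * q * q) - ℚℕ 2 * C * p
  expand = solve-∀ ℚ-ring

ℚℕ-*₃ : ∀ k m n → ℚℕ (k ℕ.* m ℕ.* n) ≡ ℚℕ k ℚ.* ℚℕ m ℚ.* ℚℕ n
ℚℕ-*₃ k m n = trans (ℚℕ-* (k ℕ.* m) n) (cong (ℚ._* ℚℕ n) (ℚℕ-* k m))

-- norm (c - z) = 2c (c - re z) because norm z = c², and |re z| = a > c.
norm-fromℕ-ₖ≢0 : ∀ {c a} z → 0 < c → c < a → norm z ≡ ℚℕ (c ℕ.* c) →
                 re z ≡ ℚℕ a ⊎ re z ≡ ℚ.- ℚℕ a → norm (fromℕ c -ₖ z) ≢ 0ℚ
norm-fromℕ-ₖ≢0 {c@(suc _)} {a} z _ c<a norm-z (inj₁ re-z) N≡0 =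
  ℕP.<-irrefl (sym (ℕP.*-cancelˡ-≡ a c (2 ℕ.* c) (ℚℕ-injective 2ca≡2cc))) c<a
  where
  open import Data.Rational using (_+_; _-_; _*_; -_)
  C = ℚℕ c
  regroup : ∀ C a → C * C + C * C - ℚℕ 2 * C * a + ℚℕ 2 * C * a ≡ ℚℕ 2 * C * C
  regroup = solve-∀ ℚ-ring
  2ca≡2cc : ℚℕ (2 ℕ.* c ℕ.* a) ≡ ℚℕ (2 ℕ.* c ℕ.* c)
  2ca≡2cc = begin
    ℚℕ (2 ℕ.* c ℕ.* a)                                   ≡⟨ ℚP.+-identityˡ _ ⟨
    0ℚ + ℚℕ (2 ℕ.* c ℕ.* a)                              ≡⟨ cong₂ _+_ (sym N≡0) (ℚℕ-*₃ 2 c a) ⟩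
    norm (fromℕ c -ₖ z) + ℚℕ 2 * C * ℚℕ a                ≡⟨ cong (_+ ℚℕ 2 * C * ℚℕ a) (norm-fromℕ-ₖ c z) ⟩
    C * C + norm z - ℚℕ 2 * C * re z + ℚℕ 2 * C * ℚℕ a   ≡⟨ cong₂ (λ u v → C * C + u - ℚℕ 2 * C * v + ℚℕ 2 * C * ℚℕ a) (trans norm-z (ℚℕ-* c c)) re-z ⟩
    C * C + C * C - ℚℕ 2 * C * ℚℕ a + ℚℕ 2 * C * ℚℕ a    ≡⟨ regroup C (ℚℕ a) ⟩
    ℚℕ 2 * C * C                                         ≡⟨ ℚℕ-*₃ 2 c c ⟨
    ℚℕ (2 ℕ.* c ℕ.* c)                                   ∎
    where open ≡-Reasoning
norm-fromℕ-ₖ≢0 {c@(suc _)} {a} z _ _ norm-z (inj₂ re-z) N≡0 = ℕP.1+n≢0 2cc+2ca≡0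
  where
  open import Data.Rational using (_+_; _-_; _*_; -_)
  C = ℚℕ c
  regroup : ∀ C a → C * C + C * C - ℚℕ 2 * C * (- a) ≡ ℚℕ 2 * C * C + ℚℕ 2 * C * a
  regroup = solve-∀ ℚ-ring
  2cc+2ca≡0 : 2 ℕ.* c ℕ.* c ℕ.+ 2 ℕ.* c ℕ.* a ≡ 0
  2cc+2ca≡0 = ℚℕ-injective $ begin
    ℚℕ (2 ℕ.* c ℕ.* c ℕ.+ 2 ℕ.* c ℕ.* a)     ≡⟨ ℚℕ-+ (2 ℕ.* c ℕ.* c) (2 ℕ.* c ℕ.* a) ⟩
    ℚℕ (2 ℕ.* c ℕ.* c) + ℚℕ (2 ℕ.* c ℕ.* a) ≡⟨ cong₂ _+_ (ℚℕ-*₃ 2 c c) (ℚℕ-*₃ 2 c a) ⟩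
    ℚℕ 2 * C * C + ℚℕ 2 * C * ℚℕ a          ≡⟨ regroup C (ℚℕ a) ⟨
    C * C + C * C - ℚℕ 2 * C * (- ℚℕ a)     ≡⟨ cong₂ (λ u v → C * C + u - ℚℕ 2 * C * v) (trans norm-z (ℚℕ-* c c)) re-z ⟨
    C * C + norm z - ℚℕ 2 * C * re z        ≡⟨ norm-fromℕ-ₖ c z ⟨
    norm (fromℕ c -ₖ z)                     ≡⟨ N≡0 ⟩
    0ℚ                                      ∎
    where open ≡-Reasoning

x₊ x₋ : ℚ√5
x₊ = (-ₖ fromℕ 3) +ₖ √5
x₋ = (-ₖ fromℕ 3) -ₖ √5

denom : ℕ → ℚ√5 → ℚ√5
denom n x = (fromℕ 2 ^ₖ n) -ₖ (x ^ₖ n)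

re-[-3±√5]^ₖ : ∀ s → s ℚ.* s ≡ 1ℚ → ∀ n →
               let z = (-ₖ (ℚℕ 3 +√5· s)) ^ₖ n in re z ≡ ℚℕ (A n) ⊎ re z ≡ ℚ.- ℚℕ (A n)
re-[-3±√5]^ₖ s s²≡1 n with -ₖ-^ₖ (ℚℕ 3 +√5· s) n
... | inj₁ even = inj₁ (cong re (trans even (3±√5-^ₖ s s²≡1 n)))
... | inj₂ odd  = inj₂ (cong re (trans odd (cong (λ z → -ₖ z) (3±√5-^ₖ s s²≡1 n))))

denom-*ₖ-invₖ : ∀ {x} → norm x ≡ ℚℕ (2 ℕ.* 2) →
                (∀ n → re (x ^ₖ n) ≡ ℚℕ (A n) ⊎ re (x ^ₖ n) ≡ ℚ.- ℚℕ (A n)) →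
                ∀ n → denom (suc n) x *ₖ invₖ (denom (suc n) x) ≡ 1ₖ
denom-*ₖ-invₖ {x} norm-x re-x^ n = *ₖ-invₖ (denom (suc n) x)
  (subst (λ d → norm (d -ₖ x ^ₖ suc n) ≢ 0ℚ) (sym (fromℕ-^ₖ 2 (suc n)))
    (norm-fromℕ-ₖ≢0 (x ^ₖ suc n) (ℕP.m^n>0 2 (suc n)) (2^n<A n) (norm-^ₖ x 2 norm-x (suc n)) (re-x^ (suc n))))

-- By computation x₊ = -(3 - √5) and x₋ = -(3 + √5), both of norm 4.
denom-x₊-*ₖ-invₖ : ∀ n → denom (suc n) x₊ *ₖ invₖ (denom (suc n) x₊) ≡ 1ₖ
denom-x₊-*ₖ-invₖ = denom-*ₖ-invₖ refl (re-[-3±√5]^ₖ (ℚ.- 1ℚ) refl)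

denom-x₋-*ₖ-invₖ : ∀ n → denom (suc n) x₋ *ₖ invₖ (denom (suc n) x₋) ≡ 1ₖ
denom-x₋-*ₖ-invₖ = denom-*ₖ-invₖ refl (re-[-3±√5]^ₖ 1ℚ refl)

open import Data.Nat using (_+_; _*_; _∸_; _%_)

module Modular (N : ℕ) where

  private
    n : ℕ
    n = suc N

  infix 4 _≋_

  _≋_ : ℕ → ℕ → Set
  a ≋ b = a % n ≡ b % n

  ≋-+ : ∀ {a b c d} → a ≋ b → c ≋ d → a + c ≋ b + d
  ≋-+ {a} {b} {c} {d} a≋b c≋d = begin
    (a + c) % n         ≡⟨ %-distribˡ-+ a c n ⟩
    (a % n + c % n) % n ≡⟨ cong₂ (λ u v → (u + v) % n) a≋b c≋d ⟩
    (b % n + d % n) % n ≡⟨ %-distribˡ-+ b d n ⟨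
    (b + d) % n         ∎
    where open ≡-Reasoning

  %-≋ : ∀ a → a % n ≋ a
  %-≋ a = m%n%n≡m%n a n

  +n-≋ : ∀ a → a + n ≋ a
  +n-≋ a = [m+n]%n≡m%n a n

  ≋-cancelʳ : ∀ a b c → a + c ≋ b + c → a ≋ b
  ≋-cancelʳ a b c a+c≋b+c = begin
    a % n               ≡⟨ [m+kn]%n≡m%n a c n ⟨
    (a + c * n) % n     ≡⟨ cong (_% n) (split a) ⟩
    (a + c + c * N) % n ≡⟨ ≋-+ {a + c} {b + c} {c * N} {c * N} a+c≋b+c refl ⟩
    (b + c + c * N) % n ≡⟨ cong (_% n) (split b) ⟨
    (b + c * n) % n     ≡⟨ [m+kn]%n≡m%n b c n ⟩
    b % n               ∎
    where
    open ≡-Reasoning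
    split : ∀ x → x + c * n ≡ x + c + c * N
    split x = trans (cong (x +_) (ℕP.*-suc c N)) (sym (ℕP.+-assoc x c (c * N)))

  ≋⇒≡ : ∀ {a b} → a < n → b < n → a ≋ b → a ≡ b
  ≋⇒≡ a<n b<n a≋b = trans (sym (m<n⇒m%n≡m a<n)) (trans a≋b (m<n⇒m%n≡m b<n))

module _ {N : ℕ} where
  open Modular N

  private
    n : ℕ
    n = suc N

  infixl 6 _-ᶠ_

  -- Chosen so that circ c i j is c (j -ᶠ i) by definition.
  _-ᶠ_ : Fin n → Fin n → Fin n
  j -ᶠ i = (n + toℕ j ∸ toℕ i) mod n

  toℕ[j-ᶠi]+i≋j : ∀ j i → toℕ (j -ᶠ i) + toℕ i ≋ toℕ j
  toℕ[j-ᶠi]+i≋j j i = begin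
    (toℕ (j -ᶠ i) + toℕ i) % n             ≡⟨ cong (λ t → (t + toℕ i) % n) (FinP.toℕ-fromℕ< (m%n<n (n + toℕ j ∸ toℕ i) n)) ⟩
    ((n + toℕ j ∸ toℕ i) % n + toℕ i) % n  ≡⟨ ≋-+ {(n + toℕ j ∸ toℕ i) % n} {n + toℕ j ∸ toℕ i} {toℕ i} {toℕ i} (%-≋ (n + toℕ j ∸ toℕ i)) refl ⟩
    (n + toℕ j ∸ toℕ i + toℕ i) % n        ≡⟨ cong (_% n) (ℕP.m∸n+n≡m i≤n+j) ⟩
    (n + toℕ j) % n                        ≡⟨ cong (_% n) (ℕP.+-comm n (toℕ j)) ⟩
    (toℕ j + n) % n                        ≡⟨ +n-≋ (toℕ j) ⟩
    toℕ j % n                              ∎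
    where
    open ≡-Reasoning
    i≤n+j : toℕ i ℕ.≤ n + toℕ j
    i≤n+j = ℕP.≤-trans (ℕP.<⇒≤ (FinP.toℕ<n i)) (ℕP.m≤m+n n (toℕ j))

  toℕ-ᶠ-unique : ∀ {z} j i → z < n → z + toℕ i ≋ toℕ j → toℕ (j -ᶠ i) ≡ z
  toℕ-ᶠ-unique {z} j i z<n z+i≋j =
    ≋⇒≡ (FinP.toℕ<n (j -ᶠ i)) z<n (≋-cancelʳ (toℕ (j -ᶠ i)) z (toℕ i) (trans (toℕ[j-ᶠi]+i≋j j i) (sym z+i≋j)))

  -ᶠ-unique : ∀ j i k → toℕ k + toℕ i ≋ toℕ j → j -ᶠ i ≡ k
  -ᶠ-unique j i k k+i≋j = FinP.toℕ-injective (toℕ-ᶠ-unique j i (FinP.toℕ<n k) k+i≋j)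

  k-ᶠ[k-ᶠm]≡m : ∀ k m → k -ᶠ (k -ᶠ m) ≡ m
  k-ᶠ[k-ᶠm]≡m k m = -ᶠ-unique k (k -ᶠ m) m
    (trans (cong (_% n) (ℕP.+-comm (toℕ m) (toℕ (k -ᶠ m)))) (toℕ[j-ᶠi]+i≋j k m))

  [k-ᶠm]-ᶠi≡[k-ᶠi]-ᶠm : ∀ k m i → (k -ᶠ m) -ᶠ i ≡ (k -ᶠ i) -ᶠ m
  [k-ᶠm]-ᶠi≡[k-ᶠi]-ᶠm k m i = -ᶠ-unique (k -ᶠ m) i r
    (≋-cancelʳ (toℕ r + toℕ i) (toℕ (k -ᶠ m)) (toℕ m) (trans r+i+m≋k (sym (toℕ[j-ᶠi]+i≋j k m))))
    where
    open ≡-Reasoning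
    r = (k -ᶠ i) -ᶠ m
    swap : ∀ a b c → a + b + c ≡ a + c + b
    swap = NatSolver.solve-∀
    r+i+m≋k : toℕ r + toℕ i + toℕ m ≋ toℕ k
    r+i+m≋k = begin
      (toℕ r + toℕ i + toℕ m) % n   ≡⟨ cong (_% n) (swap (toℕ r) (toℕ i) (toℕ m)) ⟩
      (toℕ r + toℕ m + toℕ i) % n   ≡⟨ ≋-+ {toℕ r + toℕ m} {toℕ (k -ᶠ i)} {toℕ i} {toℕ i} (toℕ[j-ᶠi]+i≋j (k -ᶠ i) m) refl ⟩
      (toℕ (k -ᶠ i) + toℕ i) % n    ≡⟨ toℕ[j-ᶠi]+i≋j k i ⟩
      toℕ k % n                     ∎

  i-ᶠi≡0 : ∀ i → i -ᶠ i ≡ zero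
  i-ᶠi≡0 i = -ᶠ-unique i i zero refl

  j-ᶠi≡0⇒i≡j : ∀ {j i} → j -ᶠ i ≡ zero → i ≡ j
  j-ᶠi≡0⇒i≡j {j} {i} j-i≡0 = FinP.toℕ-injective
    (≋⇒≡ (FinP.toℕ<n i) (FinP.toℕ<n j) (trans (cong (λ t → (toℕ t + toℕ i) % n) (sym j-i≡0)) (toℕ[j-ᶠi]+i≋j j i)))

  j-ᶠ0≡j : ∀ j → j -ᶠ zero ≡ j
  j-ᶠ0≡j j = -ᶠ-unique j zero j (cong (_% n) (ℕP.+-identityʳ (toℕ j)))

private
  module Σ = MonoidSum (CommutativeRing.+-commutativeMonoid ℚ√5-commutativeRing)

sumₖ≡sum : ∀ {n} (f : Fin n → ℚ√5) → sumₖ f ≡ Σ.sum f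
sumₖ≡sum {zero}  f = refl
sumₖ≡sum {suc n} f = cong (f zero +ₖ_) (sumₖ≡sum (f ∘ suc))

sumₖ-cong : ∀ {n} {f g : Fin n → ℚ√5} → (∀ j → f j ≡ g j) → sumₖ f ≡ sumₖ g
sumₖ-cong {f = f} {g} f≗g = trans (sumₖ≡sum f) (trans (Σ.sum-cong-≗ f≗g) (sym (sumₖ≡sum g)))

sumₖ-reflect : ∀ {N} (k : Fin (suc N)) f → sumₖ f ≡ sumₖ (λ m → f (k -ᶠ m))
sumₖ-reflect k f = trans (sumₖ≡sum f) (trans (Σ.sum-permute f reflection) (sym (sumₖ≡sum (f ∘ (k -ᶠ_)))))
  where reflection = permutation (k -ᶠ_) (k -ᶠ_) (k-ᶠ[k-ᶠm]≡m k) (k-ᶠ[k-ᶠm]≡m k)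

conv : ∀ {N} → (Fin (suc N) → ℚ√5) → (Fin (suc N) → ℚ√5) → Fin (suc N) → ℚ√5
conv c d t = sumₖ (λ m → c m *ₖ d (t -ᶠ m))

conv-comm : ∀ {N} (c d : Fin (suc N) → ℚ√5) t → conv c d t ≡ conv d c t
conv-comm c d t = trans (sumₖ-reflect t (λ m → c m *ₖ d (t -ᶠ m))) (sumₖ-cong λ m →
  trans (cong (λ j → c (t -ᶠ m) *ₖ d j) (k-ᶠ[k-ᶠm]≡m t m)) (*ₖ-comm (c (t -ᶠ m)) (d m)))

circ-⊗ : ∀ {N} (c d : Fin (suc N) → ℚ√5) i k → (circ c ⊗ circ d) i k ≡ conv d c (k -ᶠ i)
circ-⊗ c d i k = trans (sumₖ-reflect k (λ j → c (j -ᶠ i) *ₖ d (k -ᶠ j))) (sumₖ-cong λ m →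
  trans (cong₂ (λ j l → c j *ₖ d l) ([k-ᶠm]-ᶠi≡[k-ᶠi]-ᶠm k m i) (k-ᶠ[k-ᶠm]≡m k m))
        (*ₖ-comm (c ((k -ᶠ i) -ᶠ m)) (d m)))

circ-identity : ∀ {N} (i k : Fin (suc N)) → circ (identity zero) i k ≡ identity i k
circ-identity i k = if-cong (zero Fin.≟ (k -ᶠ i)) (i Fin.≟ k)
  where
  if-cong : (p : Dec (zero ≡ k -ᶠ i)) (q : Dec (i ≡ k)) → (if does p then 1ₖ else 0ₖ) ≡ (if does q then 1ₖ else 0ₖ)
  if-cong (yes _)   (yes _)    = refl
  if-cong (no _)    (no _)     = refl
  if-cong (no 0≢k-k) (yes refl) = ⊥-elim (0≢k-k (sym (i-ᶠi≡0 i)))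
  if-cong (yes 0≡k-i) (no i≢k) = ⊥-elim (i≢k (j-ᶠi≡0⇒i≡j (sym 0≡k-i)))

w : ℕ → ℚ√5 → ℕ → ℚ√5
w n x j = (fromℕ 2 ^ₖ (n ∸ j)) *ₖ (x ^ₖ j)

w-∸ : ∀ n j {k} x → n ∸ j ≡ k → w n x j ≡ (fromℕ 2 ^ₖ k) *ₖ (x ^ₖ j)
w-∸ n j x n∸j≡k = cong (λ e → (fromℕ 2 ^ₖ e) *ₖ (x ^ₖ j)) n∸j≡k

threeTerm : (ℕ → ℚ√5) → ℕ → ℕ → ℕ → ℚ√5
threeTerm f t s r = fromℕ 3 *ₖ f t +ₖ f s +ₖ f r

IsRoot : ℚ√5 → Set
IsRoot x = x *ₖ x +ₖ fromℕ 6 *ₖ x +ₖ fromℕ 4 ≡ 0ₖ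

x₊-root : IsRoot x₊
x₊-root = refl

x₋-root : IsRoot x₋
x₋-root = refl

w-recurrence : ∀ x → IsRoot x → ∀ q j → let n = 2 + q + j in
               threeTerm (w n x) (1 + j) j (2 + j) ≡ 0ₖ
w-recurrence x root q j = begin
  fromℕ 3 *ₖ w n x (1 + j) +ₖ w n x j +ₖ w n x (2 + j)
    ≡⟨ cong₂ _+ₖ_ (cong₂ (λ b a → fromℕ 3 *ₖ b +ₖ a) (w-∸ n (1 + j) x (ℕP.m+n∸n≡m (1 + q) j)) (w-∸ n j x (ℕP.m+n∸n≡m (2 + q) j)))
                  (w-∸ n (2 + j) x (ℕP.m+n∸n≡m q j)) ⟩
  fromℕ 3 *ₖ ((two *ₖ T) *ₖ (x *ₖ P)) +ₖ (two *ₖ (two *ₖ T)) *ₖ P +ₖ T *ₖ (x *ₖ (x *ₖ P))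
    ≡⟨ factor T P x ⟩
  T *ₖ P *ₖ (x *ₖ x +ₖ fromℕ 6 *ₖ x +ₖ fromℕ 4)
    ≡⟨ cong (T *ₖ P *ₖ_) root ⟩
  T *ₖ P *ₖ 0ₖ
    ≡⟨ zeroʳ (T *ₖ P) ⟩
  0ₖ ∎
  where
  open ≡-Reasoning
  n = 2 + q + j
  two = fromℕ 2
  T = two ^ₖ q
  P = x ^ₖ j
  factor : ∀ T P x → fromℕ 3 *ₖ ((two *ₖ T) *ₖ (x *ₖ P)) +ₖ (two *ₖ (two *ₖ T)) *ₖ P +ₖ T *ₖ (x *ₖ (x *ₖ P))
                   ≡ T *ₖ P *ₖ (x *ₖ x +ₖ fromℕ 6 *ₖ x +ₖ fromℕ 4)
  factor = solve-∀ ℚ√5-ring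
  zeroʳ : ∀ y → y *ₖ 0ₖ ≡ 0ₖ
  zeroʳ = solve-∀ ℚ√5-ring

w-first : ∀ x → IsRoot x → ∀ M → let n = 2 + M in
          threeTerm (w n x) 0 (1 + M) 1 ≡ (fromℚ ½ *ₖ (x +ₖ fromℕ 6)) *ₖ denom n x
w-first x root M = begin
  fromℕ 3 *ₖ w n x 0 +ₖ w n x (1 + M) +ₖ w n x 1
    ≡⟨ cong (λ a → fromℕ 3 *ₖ w n x 0 +ₖ a +ₖ w n x 1) (w-∸ n (1 + M) x (ℕP.m+n∸n≡m 1 (1 + M))) ⟩
  fromℕ 3 *ₖ ((two *ₖ (two *ₖ T)) *ₖ 1ₖ) +ₖ (two *ₖ 1ₖ) *ₖ (x *ₖ P) +ₖ (two *ₖ T) *ₖ (x *ₖ 1ₖ)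
    ≡⟨ factor T P x ⟩
  c *ₖ (two *ₖ (two *ₖ T) -ₖ x *ₖ (x *ₖ P)) +ₖ fromℚ ½ *ₖ x *ₖ P *ₖ (x *ₖ x +ₖ fromℕ 6 *ₖ x +ₖ fromℕ 4)
    ≡⟨ cong (λ r → c *ₖ denom n x +ₖ fromℚ ½ *ₖ x *ₖ P *ₖ r) root ⟩
  c *ₖ denom n x +ₖ fromℚ ½ *ₖ x *ₖ P *ₖ 0ₖ
    ≡⟨ drop (c *ₖ denom n x) (fromℚ ½ *ₖ x *ₖ P) ⟩
  c *ₖ denom n x ∎
  where
  open ≡-Reasoning
  n = 2 + M
  two = fromℕ 2
  T = two ^ₖ M
  P = x ^ₖ M
  c = fromℚ ½ *ₖ (x +ₖ fromℕ 6)
  factor : ∀ T P x →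
    fromℕ 3 *ₖ ((two *ₖ (two *ₖ T)) *ₖ 1ₖ) +ₖ (two *ₖ 1ₖ) *ₖ (x *ₖ P) +ₖ (two *ₖ T) *ₖ (x *ₖ 1ₖ)
    ≡ fromℚ ½ *ₖ (x +ₖ fromℕ 6) *ₖ (two *ₖ (two *ₖ T) -ₖ x *ₖ (x *ₖ P))
      +ₖ fromℚ ½ *ₖ x *ₖ P *ₖ (x *ₖ x +ₖ fromℕ 6 *ₖ x +ₖ fromℕ 4)
  factor = solve-∀ ℚ√5-ring
  drop : ∀ a b → a +ₖ b *ₖ 0ₖ ≡ a
  drop = solve-∀ ℚ√5-ring

w-last : ∀ x → IsRoot x → ∀ M → let n = 2 + M in
         threeTerm (w n x) (1 + M) M 0 ≡ denom n x
w-last x root M = begin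
  fromℕ 3 *ₖ w n x (1 + M) +ₖ w n x M +ₖ w n x 0
    ≡⟨ split (w n x (1 + M)) (w n x M) (w n x n) (w n x 0) ⟩
  (fromℕ 3 *ₖ w n x (1 + M) +ₖ w n x M +ₖ w n x n) +ₖ (w n x 0 -ₖ w n x n)
    ≡⟨ cong₂ _+ₖ_ (w-recurrence x root 0 M) (cong (λ e → w n x 0 -ₖ e) (w-∸ n n x (ℕP.n∸n≡0 n))) ⟩
  0ₖ +ₖ ((fromℕ 2 ^ₖ n) *ₖ 1ₖ -ₖ 1ₖ *ₖ (x ^ₖ n))
    ≡⟨ tidy (fromℕ 2 ^ₖ n) (x ^ₖ n) ⟩
  denom n x ∎
  where
  open ≡-Reasoning
  n = 2 + M
  split : ∀ b a e c → fromℕ 3 *ₖ b +ₖ a +ₖ c ≡ (fromℕ 3 *ₖ b +ₖ a +ₖ e) +ₖ (c -ₖ e)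
  split = solve-∀ ℚ√5-ring
  tidy : ∀ T X → 0ₖ +ₖ (T *ₖ 1ₖ -ₖ 1ₖ *ₖ X) ≡ T -ₖ X
  tidy = solve-∀ ℚ√5-ring

combine : ℕ → ℚ√5 → ℚ√5 → ℚ√5
combine n u v = invₖ √5 *ₖ (u *ₖ invₖ (denom n x₊) -ₖ v *ₖ invₖ (denom n x₋))

a : ℕ → ℕ → ℚ√5
a n j = combine n (w n x₊ j) (w n x₋ j)

coeff≡a : ∀ n j → coeff n j ≡ a n (toℕ j)
coeff≡a n j = regroup (fromℕ 2 ^ₖ (n ∸ toℕ j)) (invₖ √5) (x₊ ^ₖ toℕ j) (invₖ (denom n x₊)) (x₋ ^ₖ toℕ j) (invₖ (denom n x₋))
  where
  regroup : ∀ T ι P₊ e₊ P₋ e₋ → (T *ₖ ι) *ₖ (P₊ *ₖ e₊ -ₖ P₋ *ₖ e₋) ≡ ι *ₖ ((T *ₖ P₊) *ₖ e₊ -ₖ (T *ₖ P₋) *ₖ e₋)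
  regroup = solve-∀ ℚ√5-ring

threeTerm-a : ∀ n t s r → threeTerm (a n) t s r ≡ combine n (threeTerm (w n x₊) t s r) (threeTerm (w n x₋) t s r)
threeTerm-a n t s r = linear (invₖ √5) (invₖ (denom n x₊)) (invₖ (denom n x₋))
  (w n x₊ t) (w n x₋ t) (w n x₊ s) (w n x₋ s) (w n x₊ r) (w n x₋ r)
  where
  linear : ∀ ι e₊ e₋ u v u′ v′ u″ v″ →
           fromℕ 3 *ₖ (ι *ₖ (u *ₖ e₊ -ₖ v *ₖ e₋)) +ₖ ι *ₖ (u′ *ₖ e₊ -ₖ v′ *ₖ e₋) +ₖ ι *ₖ (u″ *ₖ e₊ -ₖ v″ *ₖ e₋)
           ≡ ι *ₖ ((fromℕ 3 *ₖ u +ₖ u′ +ₖ u″) *ₖ e₊ -ₖ (fromℕ 3 *ₖ v +ₖ v′ +ₖ v″) *ₖ e₋)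
  linear = solve-∀ ℚ√5-ring

combine-0 : ∀ n → combine n 0ₖ 0ₖ ≡ 0ₖ
combine-0 n = vanish (invₖ √5) (invₖ (denom n x₊)) (invₖ (denom n x₋))
  where
  vanish : ∀ ι e₊ e₋ → ι *ₖ (0ₖ *ₖ e₊ -ₖ 0ₖ *ₖ e₋) ≡ 0ₖ
  vanish = solve-∀ ℚ√5-ring

combine-denom : ∀ m c₊ c₋ → combine (suc m) (c₊ *ₖ denom (suc m) x₊) (c₋ *ₖ denom (suc m) x₋) ≡ invₖ √5 *ₖ (c₊ -ₖ c₋)
combine-denom m c₊ c₋ = begin
  ι *ₖ ((c₊ *ₖ D₊) *ₖ invₖ D₊ -ₖ (c₋ *ₖ D₋) *ₖ invₖ D₋)  ≡⟨ regroup ι c₊ c₋ D₊ D₋ (invₖ D₊) (invₖ D₋) ⟩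
  ι *ₖ (c₊ *ₖ (D₊ *ₖ invₖ D₊) -ₖ c₋ *ₖ (D₋ *ₖ invₖ D₋))  ≡⟨ cong₂ (λ d₊ d₋ → ι *ₖ (c₊ *ₖ d₊ -ₖ c₋ *ₖ d₋)) (denom-x₊-*ₖ-invₖ m) (denom-x₋-*ₖ-invₖ m) ⟩
  ι *ₖ (c₊ *ₖ 1ₖ -ₖ c₋ *ₖ 1ₖ)                             ≡⟨ cong (ι *ₖ_) (unit c₊ c₋) ⟩
  ι *ₖ (c₊ -ₖ c₋)                                         ∎
  where
  open ≡-Reasoning
  ι = invₖ √5
  D₊ = denom (suc m) x₊
  D₋ = denom (suc m) x₋
  regroup : ∀ ι c₊ c₋ D₊ D₋ e₊ e₋ → ι *ₖ ((c₊ *ₖ D₊) *ₖ e₊ -ₖ (c₋ *ₖ D₋) *ₖ e₋) ≡ ι *ₖ (c₊ *ₖ (D₊ *ₖ e₊) -ₖ c₋ *ₖ (D₋ *ₖ e₋))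
  regroup = solve-∀ ℚ√5-ring
  unit : ∀ c₊ c₋ → c₊ *ₖ 1ₖ -ₖ c₋ *ₖ 1ₖ ≡ c₊ -ₖ c₋
  unit = solve-∀ ℚ√5-ring

-- The final step is the computation (x₊ - x₋)/2 = √5.
a-first : ∀ M → let n = 2 + M in threeTerm (a n) 0 (1 + M) 1 ≡ 1ₖ
a-first M = begin
  threeTerm (a n) 0 (1 + M) 1
    ≡⟨ threeTerm-a n 0 (1 + M) 1 ⟩
  combine n (threeTerm (w n x₊) 0 (1 + M) 1) (threeTerm (w n x₋) 0 (1 + M) 1)
    ≡⟨ cong₂ (combine n) (w-first x₊ x₊-root M) (w-first x₋ x₋-root M) ⟩
  combine n (c x₊ *ₖ denom n x₊) (c x₋ *ₖ denom n x₋)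
    ≡⟨ combine-denom (1 + M) (c x₊) (c x₋) ⟩
  invₖ √5 *ₖ (c x₊ -ₖ c x₋)
    ≡⟨⟩
  1ₖ ∎
  where
  open ≡-Reasoning
  n = 2 + M
  c : ℚ√5 → ℚ√5
  c x = fromℚ ½ *ₖ (x +ₖ fromℕ 6)

a-last : ∀ M → let n = 2 + M in threeTerm (a n) (1 + M) M 0 ≡ 0ₖ
a-last M = begin
  threeTerm (a n) (1 + M) M 0
    ≡⟨ threeTerm-a n (1 + M) M 0 ⟩
  combine n (threeTerm (w n x₊) (1 + M) M 0) (threeTerm (w n x₋) (1 + M) M 0)
    ≡⟨ cong₂ (combine n) (w-last x₊ x₊-root M) (w-last x₋ x₋-root M) ⟩
  combine n (denom n x₊) (denom n x₋)
    ≡⟨ cong₂ (combine n) (sym (*ₖ-identityˡ (denom n x₊))) (sym (*ₖ-identityˡ (denom n x₋))) ⟩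
  combine n (1ₖ *ₖ denom n x₊) (1ₖ *ₖ denom n x₋)
    ≡⟨ combine-denom (1 + M) 1ₖ 1ₖ ⟩
  invₖ √5 *ₖ (1ₖ -ₖ 1ₖ)
    ≡⟨⟩
  0ₖ ∎
  where
  open ≡-Reasoning
  n = 2 + M

a-middle : ∀ q r → let n = 2 + q + r in threeTerm (a n) (1 + r) r (2 + r) ≡ 0ₖ
a-middle q r = begin
  threeTerm (a n) (1 + r) r (2 + r)
    ≡⟨ threeTerm-a n (1 + r) r (2 + r) ⟩
  combine n (threeTerm (w n x₊) (1 + r) r (2 + r)) (threeTerm (w n x₋) (1 + r) r (2 + r))
    ≡⟨ cong₂ (combine n) (w-recurrence x₊ x₊-root q r) (w-recurrence x₋ x₋-root q r) ⟩
  combine n 0ₖ 0ₖ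
    ≡⟨ combine-0 n ⟩
  0ₖ ∎
  where
  open ≡-Reasoning
  n = 2 + q + r

row31-zero : ∀ n j → toℕ j ≢ 0 → toℕ j ≢ 1 → toℕ j ≢ n ∸ 1 → row31 n j ≡ 0ₖ
row31-zero n j j≢0 j≢1 j≢n-1
  rewrite dec-false (toℕ j ℕ.≟ 0) j≢0 | dec-false (toℕ j ℕ.≟ 1) j≢1 | dec-false (toℕ j ℕ.≟ n ∸ 1) j≢n-1 = refl

row31-last : ∀ n j → toℕ j ≢ 0 → toℕ j ≡ n ∸ 1 → row31 n j ≡ 1ₖ
row31-last n j j≢0 j≡n-1
  rewrite dec-false (toℕ j ℕ.≟ 0) j≢0 | dec-true (toℕ j ℕ.≟ n ∸ 1) j≡n-1 | ∨-zeroʳ (does (toℕ j ℕ.≟ 1)) = refl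

sumₖ-row31 : ∀ p (g : Fin (3 + p) → ℚ√5) →
             sumₖ (λ m → row31 (3 + p) m *ₖ g m) ≡ fromℕ 3 *ₖ g zero +ₖ g (suc zero) +ₖ g (Fin.fromℕ (2 + p))
sumₖ-row31 p g = begin
  fromℕ 3 *ₖ g zero +ₖ (1ₖ *ₖ g (suc zero) +ₖ sumₖ tail)
    ≡⟨ cong (λ s → fromℕ 3 *ₖ g zero +ₖ (1ₖ *ₖ g (suc zero) +ₖ s)) (sumₖ≡sum tail) ⟩
  fromℕ 3 *ₖ g zero +ₖ (1ₖ *ₖ g (suc zero) +ₖ Σ.sum tail)
    ≡⟨ cong (λ s → fromℕ 3 *ₖ g zero +ₖ (1ₖ *ₖ g (suc zero) +ₖ s)) (Σ.sum-init-last tail) ⟩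
  fromℕ 3 *ₖ g zero +ₖ (1ₖ *ₖ g (suc zero) +ₖ (Σ.sum (tail ∘ inject₁) +ₖ tail (Fin.fromℕ p)))
    ≡⟨ cong₂ (λ s t → fromℕ 3 *ₖ g zero +ₖ (1ₖ *ₖ g (suc zero) +ₖ (s +ₖ t *ₖ g last)))
             (trans (Σ.sum-cong-≗ middle-zero) (Σ.sum-replicate-zero p))
             (row31-last (3 + p) last (λ ()) (cong (2 +_) (FinP.toℕ-fromℕ p))) ⟩
  fromℕ 3 *ₖ g zero +ₖ (1ₖ *ₖ g (suc zero) +ₖ (0ₖ +ₖ 1ₖ *ₖ g last))
    ≡⟨ tidy (g zero) (g (suc zero)) (g last) ⟩
  fromℕ 3 *ₖ g zero +ₖ g (suc zero) +ₖ g last ∎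
  where
  open ≡-Reasoning
  last = Fin.fromℕ (2 + p)
  tail : Fin (suc p) → ℚ√5
  tail i = row31 (3 + p) (suc (suc i)) *ₖ g (suc (suc i))
  middle-zero : ∀ i → tail (inject₁ i) ≡ 0ₖ
  middle-zero i = trans (cong (_*ₖ g (suc (suc (inject₁ i))))
                          (row31-zero (3 + p) (suc (suc (inject₁ i))) (λ ()) (λ ())
                            (FinP.toℕ-inject₁-≢ i ∘ sym ∘ ℕP.suc-injective ∘ ℕP.suc-injective)))
                        (zeroˡ (g (suc (suc (inject₁ i)))))
    where
    zeroˡ : ∀ y → 0ₖ *ₖ y ≡ 0ₖ
    zeroˡ = solve-∀ ℚ√5-ring
  tidy : ∀ a b c → fromℕ 3 *ₖ a +ₖ (1ₖ *ₖ b +ₖ (0ₖ +ₖ 1ₖ *ₖ c)) ≡ fromℕ 3 *ₖ a +ₖ b +ₖ c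
  tidy = solve-∀ ℚ√5-ring

coeff-threeTerm : ∀ n t s r → fromℕ 3 *ₖ coeff n t +ₖ coeff n s +ₖ coeff n r ≡ threeTerm (a n) (toℕ t) (toℕ s) (toℕ r)
coeff-threeTerm n t s r = cong₂ _+ₖ_ (cong₂ (λ u v → fromℕ 3 *ₖ u +ₖ v) (coeff≡a n t) (coeff≡a n s)) (coeff≡a n r)

module _ (p : ℕ) where
  private
    N n : ℕ
    N = 2 + p
    n = 3 + p
    last : Fin n
    last = Fin.fromℕ N
  open Modular N

  conv-row31 : ∀ (c : Fin n → ℚ√5) t → conv (row31 n) c t ≡ fromℕ 3 *ₖ c t +ₖ c (t -ᶠ suc zero) +ₖ c (t -ᶠ last)
  conv-row31 c t = trans (sumₖ-row31 p (λ m → c (t -ᶠ m)))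
    (cong (λ u → fromℕ 3 *ₖ c u +ₖ c (t -ᶠ suc zero) +ₖ c (t -ᶠ last)) (j-ᶠ0≡j t))

  private
    Vanishes : Fin N → Set
    Vanishes r = threeTerm (a n) (toℕ (suc r)) (toℕ (suc r -ᶠ suc zero)) (toℕ (suc r -ᶠ last)) ≡ 0ₖ

    toℕ[1+r-ᶠ1]≡r : ∀ r → toℕ (suc r -ᶠ suc zero) ≡ toℕ r
    toℕ[1+r-ᶠ1]≡r r = toℕ-ᶠ-unique (suc r) (suc zero) (ℕP.<-trans (FinP.toℕ<n r) (ℕP.n<1+n N)) (cong (_% n) (ℕP.+-comm (toℕ r) 1))

  threeTerm-a-middle : ∀ r → suc (toℕ r) < N → Vanishes r
  threeTerm-a-middle r 1+k<N = trans (cong₂ (threeTerm (a n) (suc k)) (toℕ[1+r-ᶠ1]≡r r) [t-last]≡2+k)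
                                     (subst (λ m → threeTerm (a m) (1 + k) k (2 + k) ≡ 0ₖ) 2+q+k≡n (a-middle q k))
    where
    k = toℕ r
    2+k≤n : 2 + k ℕ.≤ n
    2+k≤n = ℕP.<⇒≤ (ℕ.s≤s 1+k<N)
    q = proj₁ (ℕP.m≤n⇒∃[o]m+o≡n 2+k≤n)
    2+q+k≡n : 2 + q + k ≡ n
    2+q+k≡n = trans (cong (2 +_) (ℕP.+-comm q k)) (proj₂ (ℕP.m≤n⇒∃[o]m+o≡n 2+k≤n))
    [t-last]≡2+k : toℕ (suc r -ᶠ last) ≡ 2 + k
    [t-last]≡2+k = toℕ-ᶠ-unique (suc r) last (ℕ.s≤s 1+k<N)
      (trans (cong (λ x → (2 + k + x) % n) (FinP.toℕ-fromℕ N))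
             (trans (cong (_% n) (sym (ℕP.+-suc (suc k) N))) ([m+n]%n≡m%n (suc k) n)))

  threeTerm-a-last : ∀ r → suc (toℕ r) ≡ N → Vanishes r
  threeTerm-a-last r 1+k≡N = trans (cong₂ (threeTerm (a n) (suc k)) (toℕ[1+r-ᶠ1]≡r r) [t-last]≡0)
                                   (subst (λ j → threeTerm (a n) (suc j) j 0 ≡ 0ₖ) (sym (ℕP.suc-injective 1+k≡N)) (a-last (1 + p)))
    where
    k = toℕ r
    [t-last]≡0 : toℕ (suc r -ᶠ last) ≡ 0
    [t-last]≡0 = toℕ-ᶠ-unique (suc r) last (ℕ.s≤s ℕ.z≤n) (cong (_% n) (trans (FinP.toℕ-fromℕ N) (sym 1+k≡N)))

  threeTerm-a-entry : ∀ t → threeTerm (a n) (toℕ t) (toℕ (t -ᶠ suc zero)) (toℕ (t -ᶠ last)) ≡ identity zero t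
  threeTerm-a-entry zero = trans (cong₂ (threeTerm (a n) 0) [0-1]≡N [0-last]≡1) (a-first (1 + p))
    where
    [0-1]≡N : toℕ (zero -ᶠ suc zero) ≡ N
    [0-1]≡N = toℕ-ᶠ-unique zero (suc zero) (ℕP.n<1+n N) (trans (cong (_% n) (ℕP.+-comm N 1)) (n%n≡0 n))
    [0-last]≡1 : toℕ (zero -ᶠ last) ≡ 1
    [0-last]≡1 = toℕ-ᶠ-unique zero last (ℕ.s≤s (ℕ.s≤s ℕ.z≤n)) (trans (cong (λ x → (1 + x) % n) (FinP.toℕ-fromℕ N)) (n%n≡0 n))
  threeTerm-a-entry (suc r) =
    [ threeTerm-a-middle r , threeTerm-a-last r ]′ (ℕP.m<1+n⇒m<n∨m≡n (FinP.toℕ<n (suc r)))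

  conv-row31-coeff : ∀ t → conv (row31 n) (coeff n) t ≡ identity zero t
  conv-row31-coeff t = trans (conv-row31 (coeff n) t)
    (trans (coeff-threeTerm n t (t -ᶠ suc zero) (t -ᶠ last)) (threeTerm-a-entry t))

  circ-row31-inverse : IsInverse (circ (row31 n)) (circ (coeff n))
  circ-row31-inverse = (λ i k → begin
      (circ (row31 n) ⊗ circ (coeff n)) i k  ≡⟨ circ-⊗ (row31 n) (coeff n) i k ⟩
      conv (coeff n) (row31 n) (k -ᶠ i)      ≡⟨ conv-comm (coeff n) (row31 n) (k -ᶠ i) ⟩
      conv (row31 n) (coeff n) (k -ᶠ i)      ≡⟨ conv-row31-coeff (k -ᶠ i) ⟩
      identity zero (k -ᶠ i)                 ≡⟨ circ-identity i k ⟩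
      identity i k                           ∎)
    , (λ i k → begin
      (circ (coeff n) ⊗ circ (row31 n)) i k  ≡⟨ circ-⊗ (coeff n) (row31 n) i k ⟩
      conv (row31 n) (coeff n) (k -ᶠ i)      ≡⟨ conv-row31-coeff (k -ᶠ i) ⟩
      identity zero (k -ᶠ i)                 ≡⟨ circ-identity i k ⟩
      identity i k                           ∎)
    where open ≡-Reasoning

mainTheorem3 : (n : ℕ) → 3 < n → IsInverse (circ (row31 n)) (circ (coeff n))
mainTheorem3 _ (ℕ.s≤s (ℕ.s≤s (ℕ.s≤s (ℕ.s≤s _)))) = circ-row31-inverse _
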